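{- Let $S$ be a numerical semigroup of depth $q\ge 4$ such that $|L|\le 12$. Then $\alpha_1\le 2$.
   Context: A numerical semigroup is a submonoid $S$ of $(\mathbb N,+)$ with $\mathbb N\setminus S$ finite. Let $m=\min(S\setminus\{0\})$ (multiplicity), $c$ the least $c\in\mathbb N$ with $[c,\infty[\subseteq S$ (conductor), $L=S\cap[0,c-1]$ (left part), depth $q=\lceil c/m\rceil$, offset $\rho=qm-c$. Let $I_1=[m-\rho,2m-\rho-1]$, let $A=\{x\in S: x-m\notin S\}$ be the Apéry set with respect to $m$, and $\alpha_1=|A\cap I_1|$. -}

module Defs where

open import Data.Nat using (ℕ; zero; suc; _+_; _*_; _∸_; _≤_; _<_; _≤?_; NonZero)
open import Data.Nat.DivMod using (_/_)
open import Data.Nat.Properties using ()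
open import Data.List using (List; length; filter; upTo; map)
open import Data.Product using (Σ; ∃; _×_; _,_)
open import Relation.Nullary using (¬_; Dec; yes; no)
open import Relation.Nullary.Decidable using (¬?; _×-dec_; _→-dec_)
open import Relation.Unary using (Pred; Decidable)
open import Level using (0ℓ)

record NumericalSemigroup : Set₁ where
  field
    _∈S   : ℕ → Set
    _∈S?  : (n : ℕ) → Dec (n ∈S)
    zero∈ : zero ∈S
    +-closed : ∀ {a b} → a ∈S → b ∈S → (a + b) ∈S
    cofinite : ∃ λ N → ∀ n → N ≤ n → n ∈S

open NumericalSemigroup public

IsMultiplicity : NumericalSemigroup → ℕ → Set
IsMultiplicity S m = (0 < m) × (_∈S S m) × (∀ x → 0 < x → _∈S S x → m ≤ x)

IsConductor : NumericalSemigroup → ℕ → Set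
IsConductor S c = (∀ n → c ≤ n → _∈S S n)
                × (∀ d → (∀ n → d ≤ n → _∈S S n) → c ≤ d)

countIn : {P : Pred ℕ 0ℓ} → Decidable P → ℕ → ℕ → ℕ
countIn P? a len = length (filter P? (map (a +_) (upTo len)))

-- depth q = ⌈ c / m ⌉  (for m > 0)
depth : (c m : ℕ) → .{{NonZero m}} → ℕ
depth c m = (c + m ∸ 1) / m

offset : (c m : ℕ) → .{{NonZero m}} → ℕ
offset c m = depth c m * m ∸ c

leftPartSize : NumericalSemigroup → ℕ → ℕ
leftPartSize S c = countIn (_∈S? S) 0 c

-- Apéry set with respect to m: x ∈ S and x - m ∉ S
-- (when x < m, x - m ∉ ℕ, hence ∉ S; so the second condition only bites if m ≤ x)
InApery : NumericalSemigroup → ℕ → ℕ → Set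
InApery S m x = (_∈S S x) × (m ≤ x → ¬ (_∈S S (x ∸ m)))

InApery? : (S : NumericalSemigroup) (m : ℕ) → Decidable (InApery S m)
InApery? S m x = (_∈S? S) x ×-dec (m ≤? x →-dec ¬? ((_∈S? S) (x ∸ m)))

-- α₁ = | A ∩ I₁ |,  I₁ = [m − ρ, 2m − ρ − 1], a block of m consecutive integers
alpha1 : (S : NumericalSemigroup) (m c : ℕ) → .{{NonZero m}} → ℕ
alpha1 S m c = countIn (InApery? S m) (m ∸ offset c m) m

-- The left part contains 0 and the m-blocks I₁, …, I_{q−1}, the last of
-- which ends at c − 1. Adding m maps S ∩ I_k into S ∩ I_{k+1}, and S ∩ I₁
-- contains, besides the α₁ Apéry elements of I₁, the element m, which is not
-- in the Apéry set. Hence |L| ≥ 1 + (q − 1)(α₁ + 1), and q ≥ 4 with |L| ≤ 12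
-- leaves no room for α₁ ≥ 3.
module Submission where

open import Defs
open import Data.Nat using (ℕ; zero; suc; _+_; _*_; _∸_; _≤_; _<_; z≤n; s≤s; NonZero; >-nonZero⁻¹)
open import Data.Nat.Properties
open import Data.Nat.DivMod using (_%_; m≡m%n+[m/n]*n; m%n<n)
open import Data.List using (length; filter; applyUpTo)
open import Data.List.Properties using (map-upTo; filter-accept; filter-reject)
open import Data.Product using (_,_; proj₁)
open import Data.Sum using (inj₁; inj₂)
open import Relation.Nullary using (¬_; yes; no; contradiction)
open import Relation.Unary using (Pred; Decidable)
open import Relation.Binary.PropositionalEquality
open import Level using (0ℓ)
open import Function using (_∘_)

module _ (c m : ℕ) .{{_ : NonZero m}} where

  private
    c+m≡1+[c+m∸1]%m+depth*m : c + m ≡ suc ((c + m ∸ 1) % m + depth c m * m)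
    c+m≡1+[c+m∸1]%m+depth*m = begin
      c + m                                 ≡⟨ sym (m∸n+n≡m (≤-trans (>-nonZero⁻¹ m) (m≤n+m m c))) ⟩
      c + m ∸ 1 + 1                         ≡⟨ +-comm (c + m ∸ 1) 1 ⟩
      suc (c + m ∸ 1)                       ≡⟨ cong suc (m≡m%n+[m/n]*n (c + m ∸ 1) m) ⟩
      suc ((c + m ∸ 1) % m + depth c m * m) ∎
      where open ≡-Reasoning

  c≤depth*m : c ≤ depth c m * m
  c≤depth*m = +-cancelʳ-≤ m c (depth c m * m) (begin
    c + m                                 ≡⟨ c+m≡1+[c+m∸1]%m+depth*m ⟩
    suc ((c + m ∸ 1) % m + depth c m * m) ≤⟨ +-monoˡ-≤ (depth c m * m) (m%n<n (c + m ∸ 1) m) ⟩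
    m + depth c m * m                     ≡⟨ +-comm m (depth c m * m) ⟩
    depth c m * m + m                     ∎)
    where open ≤-Reasoning

  depth*m<c+m : depth c m * m < c + m
  depth*m<c+m = subst (depth c m * m <_) (sym c+m≡1+[c+m∸1]%m+depth*m)
                      (s≤s (m≤n+m (depth c m * m) ((c + m ∸ 1) % m)))

  offset+c≡depth*m : offset c m + c ≡ depth c m * m
  offset+c≡depth*m = m∸n+n≡m c≤depth*m

  offset<m : offset c m < m
  offset<m = +-cancelʳ-< c (offset c m) m (begin-strict
    offset c m + c ≡⟨ offset+c≡depth*m ⟩
    depth c m * m  <⟨ depth*m<c+m ⟩
    c + m          ≡⟨ +-comm c m ⟩
    m + c          ∎)
    where open ≤-Reasoning

  m∸offset+[depth∸1]*m≡c : 1 ≤ depth c m → (m ∸ offset c m) + (depth c m ∸ 1) * m ≡ c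
  m∸offset+[depth∸1]*m≡c 1≤q = +-cancelʳ-≡ ρ _ c (begin
    (m ∸ ρ) + k * m + ρ   ≡⟨ +-assoc (m ∸ ρ) (k * m) ρ ⟩
    (m ∸ ρ) + (k * m + ρ) ≡⟨ cong ((m ∸ ρ) +_) (+-comm (k * m) ρ) ⟩
    (m ∸ ρ) + (ρ + k * m) ≡⟨ sym (+-assoc (m ∸ ρ) ρ (k * m)) ⟩
    (m ∸ ρ) + ρ + k * m   ≡⟨ cong (_+ k * m) (m∸n+n≡m (<⇒≤ offset<m)) ⟩
    (1 + k) * m           ≡⟨ cong (_* m) (m+[n∸m]≡n 1≤q) ⟩
    depth c m * m         ≡⟨ sym offset+c≡depth*m ⟩
    ρ + c                 ≡⟨ +-comm ρ c ⟩
    c + ρ                 ∎)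
    where
    open ≡-Reasoning
    ρ = offset c m
    k = depth c m ∸ 1

module _ {P : Pred ℕ 0ℓ} (P? : Decidable P) where

  count : ℕ → ℕ → ℕ
  count a zero = 0
  count a (suc n) with P? a
  ... | yes _ = suc (count (suc a) n)
  ... | no  _ = count (suc a) n

  private
    length-filter-applyUpTo : ∀ f a n → (∀ i → f i ≡ a + i) →
                              length (filter P? (applyUpTo f n)) ≡ count a n
    length-filter-applyUpTo f a zero    f≗a+ = refl
    length-filter-applyUpTo f a (suc n) f≗a+ =
      extend (trans (f≗a+ 0) (+-identityʳ a))
             (length-filter-applyUpTo (f ∘ suc) (suc a) n (λ i → trans (f≗a+ (suc i)) (+-suc a i)))
      where
      extend : f 0 ≡ a → length (filter P? (applyUpTo (f ∘ suc) n)) ≡ count (suc a) n →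
               length (filter P? (applyUpTo f (suc n))) ≡ count a (suc n)
      extend f0≡a IH with P? a
      ... | yes Pa = trans (cong length (filter-accept P? (subst P (sym f0≡a) Pa))) (cong suc IH)
      ... | no ¬Pa = trans (cong length (filter-reject P? (¬Pa ∘ subst P f0≡a))) IH

  countIn≡count : ∀ a n → countIn P? a n ≡ count a n
  countIn≡count a n = trans (cong (λ xs → length (filter P? xs)) (map-upTo (a +_) n))
                            (length-filter-applyUpTo (a +_) a n (λ _ → refl))

  count-+ : ∀ a n k → count a (n + k) ≡ count a n + count (a + n) k
  count-+ a zero    k rewrite +-identityʳ a = refl
  count-+ a (suc n) k rewrite +-suc a n with P? a
  ... | yes _ = cong suc (count-+ (suc a) n k)
  ... | no  _ = count-+ (suc a) n k

  0<count : ∀ {a n} → P a → 0 < n → 0 < count a n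
  0<count {a} {suc n} Pa _ with P? a
  ... | yes _  = s≤s z≤n
  ... | no ¬Pa = contradiction Pa ¬Pa

  count-shift : ∀ {d} → (∀ x → P x → P (x + d)) → ∀ a n → count a n ≤ count (a + d) n
  count-shift closed a zero    = z≤n
  count-shift {d} closed a (suc n) with P? a | P? (a + d)
  ... | yes _  | yes _   = s≤s (count-shift closed (suc a) n)
  ... | yes Pa | no ¬Pad = contradiction (closed a Pa) ¬Pad
  ... | no _   | yes _   = m≤n⇒m≤1+n (count-shift closed (suc a) n)
  ... | no _   | no _    = count-shift closed (suc a) n

  *-count≤count-* : ∀ {d} → (∀ x → P x → P (x + d)) → ∀ k a → k * count a d ≤ count a (k * d)
  *-count≤count-* closed zero    a = z≤n
  *-count≤count-* {d} closed (suc k) a = begin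
    count a d + k * count a d         ≤⟨ +-monoʳ-≤ (count a d) (*-monoʳ-≤ k (count-shift closed a d)) ⟩
    count a d + k * count (a + d) d   ≤⟨ +-monoʳ-≤ (count a d) (*-count≤count-* closed k (a + d)) ⟩
    count a d + count (a + d) (k * d) ≡⟨ count-+ a d (k * d) ⟨
    count a (d + k * d)               ∎
    where open ≤-Reasoning

module _ {P Q : Pred ℕ 0ℓ} (P? : Decidable P) (Q? : Decidable Q) (P⊆Q : ∀ {x} → P x → Q x) where

  count-mono : ∀ a n → count P? a n ≤ count Q? a n
  count-mono a zero    = z≤n
  count-mono a (suc n) with P? a | Q? a
  ... | yes _  | yes _  = s≤s (count-mono (suc a) n)
  ... | yes Pa | no ¬Qa = contradiction (P⊆Q Pa) ¬Qa
  ... | no _   | yes _  = m≤n⇒m≤1+n (count-mono (suc a) n)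
  ... | no _   | no _   = count-mono (suc a) n

  count-< : ∀ {x} a n → a ≤ x → x < a + n → Q x → ¬ P x → count P? a n < count Q? a n
  count-< a zero    a≤x x<a+0 _ _ = contradiction (subst (_ <_) (+-identityʳ a) x<a+0) (≤⇒≯ a≤x)
  count-< {x} a (suc n) a≤x x<a+1+n Qx ¬Px with m≤n⇒m<n∨m≡n a≤x
  ... | inj₂ refl = first-differs
    where
    first-differs : count P? a (suc n) < count Q? a (suc n)
    first-differs with P? a | Q? a
    ... | yes Pa | _      = contradiction Pa ¬Px
    ... | no _   | yes _  = s≤s (count-mono (suc a) n)
    ... | no _   | no ¬Qa = contradiction Qx ¬Qa
  ... | inj₁ a<x = extend (count-< (suc a) n a<x (subst (x <_) (+-suc a n) x<a+1+n) Qx ¬Px)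
    where
    extend : count P? (suc a) n < count Q? (suc a) n → count P? a (suc n) < count Q? a (suc n)
    extend P<Q with P? a | Q? a
    ... | yes _  | yes _  = s≤s P<Q
    ... | yes Pa | no ¬Qa = contradiction (P⊆Q Pa) ¬Qa
    ... | no _   | yes _  = m<n⇒m<1+n P<Q
    ... | no _   | no _   = P<Q

module _ (S : NumericalSemigroup) {m : ℕ} where

  m∉Apéry : ¬ InApery S m m
  m∉Apéry (_ , m-m∉S) = m-m∉S ≤-refl (subst (_∈S S) (sym (n∸n≡0 m)) (zero∈ S))

  count-Apéry<count-∈S : _∈S S m → ∀ a → a ≤ m → m < a + m →
                         count (InApery? S m) a m < count (_∈S? S) a m
  count-Apéry<count-∈S m∈S a a≤m m<a+m =
    count-< (InApery? S m) (_∈S? S) proj₁ a m a≤m m<a+m m∈S m∉Apéry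

  1+[depth∸1]*[1+alpha1]≤leftPartSize : ∀ c .{{_ : NonZero m}} → _∈S S m → 1 ≤ depth c m →
                                         1 + (depth c m ∸ 1) * suc (alpha1 S m c) ≤ leftPartSize S c
  1+[depth∸1]*[1+alpha1]≤leftPartSize c m∈S 1≤q = begin
    1 + k * suc (alpha1 S m c)        ≡⟨ cong (λ α → 1 + k * suc α) (countIn≡count A? a m) ⟩
    1 + k * suc (count A? a m)        ≤⟨ +-mono-≤ (0<count S? (zero∈ S) 0<a) (*-monoʳ-≤ k A<S) ⟩
    count S? 0 a + k * count S? a m   ≤⟨ +-monoʳ-≤ (count S? 0 a) (*-count≤count-* S? +m-closed k a) ⟩
    count S? 0 a + count S? a (k * m) ≡⟨ count-+ S? 0 a (k * m) ⟨
    count S? 0 (a + k * m)            ≡⟨ cong (count S? 0) (m∸offset+[depth∸1]*m≡c c m 1≤q) ⟩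
    count S? 0 c                      ≡⟨ countIn≡count S? 0 c ⟨
    leftPartSize S c                  ∎
    where
    open ≤-Reasoning
    S? = _∈S? S
    A? = InApery? S m
    k = depth c m ∸ 1
    a = m ∸ offset c m
    0<a : 0 < a
    0<a = m<n⇒0<n∸m (offset<m c m)
    A<S : suc (count A? a m) ≤ count S? a m
    A<S = count-Apéry<count-∈S m∈S a (m∸n≤m m (offset c m)) (m<n+m m 0<a)
    +m-closed : ∀ x → _∈S S x → _∈S S (x + m)
    +m-closed x x∈S = +-closed S x∈S m∈S

lemma4p3 : (S : NumericalSemigroup) (m c : ℕ) .{{_ : NonZero m}} →
           IsMultiplicity S m → IsConductor S c →
           4 ≤ depth c m → leftPartSize S c ≤ 12 →
           alpha1 S m c ≤ 2
lemma4p3 S m c (_ , m∈S , _) _ 4≤q |L|≤12 = ≮⇒≥ λ 2<α → <-irrefl refl (begin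
  13                                       ≤⟨ s≤s (*-mono-≤ (∸-monoˡ-≤ 1 4≤q) (s≤s 2<α)) ⟩
  1 + (depth c m ∸ 1) * suc (alpha1 S m c) ≤⟨ 1+[depth∸1]*[1+alpha1]≤leftPartSize S c m∈S 1≤q ⟩
  leftPartSize S c                         ≤⟨ |L|≤12 ⟩
  12                                       ∎)
  where
  open ≤-Reasoning
  1≤q : 1 ≤ depth c m
  1≤q = ≤-trans (s≤s z≤n) 4≤q
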